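{- Let $N\ge 1$ and $\tau\in\operatorname{SL}_2(\mathbb{Z})$. Then there exist a subset $S$ of $\mathcal{P}_N$, an Atkin--Lehner operator $W\in\mathcal{W}(S)$, positive integers $M_1,M$ such that $M^2\mid N$, $M_1=\gcd(M,N_S)$ and $M_1^2\mid N_S$, and a rational number $t$, such that the matrix $$\sigma = W\,\tau\,\begin{pmatrix}1&t\\0&1\end{pmatrix}\begin{pmatrix}1/M_1&0\\0&M_1/N_S\end{pmatrix}$$ satisfies (1) $\sigma\in\operatorname{SL}_2(\mathbb{Z})$, and (2) $C(\sigma)=N/M$.
   Context: Write $N=\prod_p p^{n_p}$ and let $\mathcal{P}_N$ be the set of primes dividing $N$. For $S\subseteq\mathcal{P}_N$, $N_S=\prod_{p\in S}p^{n_p}$ (with $N_\emptyset=1$), and $\mathcal{W}(S)=\{W\in M_2(\mathbb{Z}): W\equiv\begin{pmatrix}0&*\\0&0\end{pmatrix}\ (\mathrm{mod}\ N_S),\ W\equiv\begin{pmatrix}*&*\\0&*\end{pmatrix}\ (\mathrm{mod}\ N),\ \det W=N_S\}$ (the Atkin--Lehner operators). For $\sigma=\begin{pmatrix}a&b\\c&d\end{pmatrix}\in\operatorname{SL}_2(\mathbb{Z})$, $C(\sigma)=\gcd(c,N)$ (positive gcd). -}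

module Defs where

open import Data.Nat as ℕ using (ℕ; zero; suc; _^_; NonZero)
open import Data.Nat.Divisibility using (_∣?_)
open import Data.Nat.DivMod using (_/_)
open import Data.Nat.Primality using (Prime)
open import Data.Integer as ℤ using (ℤ; +_)
open import Data.Integer.Divisibility as ℤD using ()
open import Data.Rational as ℚ using (ℚ)
open import Data.List using (List; map)
open import Data.Nat.ListAction using (product)
open import Data.List.Relation.Unary.All using (All)
open import Data.List.Relation.Unary.Unique.Propositional using (Unique)
open import Data.Product using (_×_)
open import Relation.Nullary using (yes; no)

-- p-adic valuation v_p(n), computed with fuel (fuel = n suffices for n ≥ 1).
-- For p ≤ 1 it returns 0 (never used: p is prime in the statement).
valAux : ℕ → ℕ → ℕ → ℕ
valAux zero p n = 0
valAux (suc f) 0 n = 0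
valAux (suc f) 1 n = 0
valAux (suc f) (suc (suc k)) n with suc (suc k) ∣? n
... | yes _ = suc (valAux f (suc (suc k)) (n / suc (suc k)))
... | no _ = 0

val : ℕ → ℕ → ℕ
val p n = valAux n p n

-- S ⊆ 𝒫_N, represented as a duplicate-free list of primes dividing N.
IsSubsetPN : ℕ → List ℕ → Set
IsSubsetPN N S = Unique S × All (λ p → Prime p × (p Data.Nat.Divisibility.∣ N)) S
  where import Data.Nat.Divisibility

NS : ℕ → List ℕ → ℕ
NS N S = product (map (λ p → p ^ val p N) S)

record Mat2 (A : Set) : Set where
  constructor mat
  field
    a b c d : A
open Mat2 public

detℤ : Mat2 ℤ → ℤ
detℤ (mat a b c d) = a ℤ.* d ℤ.- b ℤ.* c

mulℤ : Mat2 ℤ → Mat2 ℤ → Mat2 ℤ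
mulℤ (mat a b c d) (mat a' b' c' d') =
  mat (a ℤ.* a' ℤ.+ b ℤ.* c') (a ℤ.* b' ℤ.+ b ℤ.* d')
      (c ℤ.* a' ℤ.+ d ℤ.* c') (c ℤ.* b' ℤ.+ d ℤ.* d')

mulℚ : Mat2 ℚ → Mat2 ℚ → Mat2 ℚ
mulℚ (mat a b c d) (mat a' b' c' d') =
  mat (a ℚ.* a' ℚ.+ b ℚ.* c') (a ℚ.* b' ℚ.+ b ℚ.* d')
      (c ℚ.* a' ℚ.+ d ℚ.* c') (c ℚ.* b' ℚ.+ d ℚ.* d')

ℤtoℚ : ℤ → ℚ
ℤtoℚ z = z ℚ./ 1

toℚ : Mat2 ℤ → Mat2 ℚ
toℚ (mat a b c d) = mat (ℤtoℚ a) (ℤtoℚ b) (ℤtoℚ c) (ℤtoℚ d)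

IsSL2ℤ : Mat2 ℤ → Set
IsSL2ℤ τ = detℤ τ Relation.Binary.PropositionalEquality.≡ + 1
  where import Relation.Binary.PropositionalEquality

IsAtkinLehner : ℕ → List ℕ → Mat2 ℤ → Set
IsAtkinLehner N S W =
  (+ NS N S ℤD.∣ a W) × (+ NS N S ℤD.∣ c W) × (+ NS N S ℤD.∣ d W)
  × (+ N ℤD.∣ c W)
  × (detℤ W Relation.Binary.PropositionalEquality.≡ + NS N S)
  where import Relation.Binary.PropositionalEquality

-- the rational n / m; total version (value 0 when m = 0, a case that never
-- arises below since M₁ > 0 and N_S > 0).
fracℚ : ℤ → ℕ → ℚ
fracℚ n zero = ℚ.0ℚ
fracℚ n (suc m) = n ℚ./ suc m

Tmat : ℚ → Mat2 ℚ
Tmat t = mat ℚ.1ℚ t ℚ.0ℚ ℚ.1ℚ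

Dmat : ℕ → ℕ → Mat2 ℚ
Dmat M₁ NS' = mat (fracℚ (+ 1) M₁) ℚ.0ℚ ℚ.0ℚ (fracℚ (+ M₁) NS')

Cσ : ℕ → Mat2 ℤ → ℕ
Cσ N σ = Data.Nat.GCD.gcd (ℤ.∣ c σ ∣) N
  where import Data.Nat.GCD

-- Split N = A·B with A = N_S: a prime power p^n ∥ N goes into A when gcd(c, p^n)² ∣ p^n and into B
-- when p^n ∣ gcd(c, p^n)²; one of the two always holds because the divisors of p^n are totally ordered
-- by divisibility, and both conditions survive coprime products. With M₁ = gcd(c, A), B = k·gcd(c, B)
-- and M = M₁k this gives M² ∣ N and M₁ = gcd(M, A). For Ax − By = 1 the Atkin–Lehner matrix
-- W = (Ax y; N A) makes the first column of Wτ equal to M₁·(X, Z) with X, Z coprime and Z = A′(Ba + c),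
-- where A = A′M₁. Completing (X, Z) to σ ∈ SL₂(ℤ), the matrices σ and Wτ·diag(1/M₁, M₁/A) share their
-- first column and determinant, so they differ by a unipotent upper triangular factor, which is T(t)
-- moved past the diagonal matrix. Finally gcd(Z, N) = A′·gcd(Ba + c, M₁B) = A′·gcd(c, B) = N/M.

module Submission where

open import Defs
open import Data.Nat as ℕ
  using (ℕ; zero; suc; _+_; _*_; _^_; _≤_; _<_; _≥_; z≤n; s≤s; NonZero; NonTrivial; ≢-nonZero)
open import Data.Nat.Properties as ℕP using (m<m*n; *-comm; *-assoc)
open import Data.Nat.Divisibility
open import Data.Nat.DivMod using (_/_; m*n/n≡m)
open import Data.Nat.GCD
open import Data.Nat.Coprimality as Coprime using (Coprime; coprime-divisor; coprime⇒gcd≡1)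
open import Data.Nat.Primality using (Prime; prime⇒irreducible; prime⇒nonZero; prime⇒nonTrivial; euclidsLemma)
open import Data.Nat.Primality.Factorisation using (factorise; PrimeFactorisation)
open import Data.Nat.Induction using (<-wellFounded)
open import Data.Nat.Tactic.RingSolver using (solve-∀)
open import Data.List using (List; []; _∷_)
open import Data.List.Relation.Unary.All as All using (All; []; _∷_)
import Data.List.Relation.Unary.AllPairs as AllPairs
open import Data.Empty using (⊥-elim)
open import Data.Sum using (_⊎_; inj₁; inj₂)
open import Data.Product using (Σ; ∃; ∃₂; _×_; _,_; proj₁; proj₂)
open import Induction.WellFounded using (Acc; acc)
open import Relation.Nullary using (yes; no; ¬_)
open import Relation.Binary.PropositionalEquality
open import Data.Integer as ℤ using (ℤ; +_; 1ℤ)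
import Data.Integer.Properties as ℤP
import Data.Integer.Divisibility.Signed as ℤ∣
import Data.Integer.Coprimality as ℤCoprime
import Data.Integer.Tactic.RingSolver as ℤRing
open import Data.Rational as ℚ using (ℚ; 1ℚ; 0ℚ; fromℚᵘ)
import Data.Rational.Properties as ℚP
open import Data.Rational.Unnormalised as ℚᵘ using (mkℚᵘ; *≡*)
import Data.Rational.Unnormalised.Properties as ℚᵘP
import Tactic.RingSolver as RingSolver
import Tactic.RingSolver.Core.AlmostCommutativeRing as ACR
open import Data.Maybe using (Maybe; just; nothing)
open import Level using (0ℓ)

-- p-adic valuations

∤⇒≢0 : ∀ {q r} → ¬ q ∣ r → NonZero r
∤⇒≢0 {q} {zero} q∤0 = ⊥-elim (q∤0 (q ∣0))
∤⇒≢0 {q} {suc r} _ = _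

n<q*n : ∀ q n .{{_ : NonTrivial q}} .{{_ : NonZero n}} → n < q * n
n<q*n q n = subst (n <_) (*-comm n q) (m<m*n n q (ℕ.nonTrivial⇒n>1 q))

q*n/q≡n : ∀ q n .{{_ : NonZero q}} → q * n / q ≡ n
q*n/q≡n q n = trans (cong (_/ q) (*-comm q n)) (m*n/n≡m n q)

valAux[q^k*r]≡k : ∀ {q} .{{_ : NonTrivial q}} f k {r} → ¬ q ∣ r → q ^ k * r ≤ f →
                  valAux f q (q ^ k * r) ≡ k
valAux[q^k*r]≡k {q@(suc (suc _))} f k {r} q∤r = go f k
  where
  q^k*r≢0 : ∀ k → NonZero (q ^ k * r)
  q^k*r≢0 k = ℕP.m*n≢0 (q ^ k) r {{ℕP.m^n≢0 q k}} {{∤⇒≢0 q∤r}}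
  go : ∀ f k → q ^ k * r ≤ f → valAux f q (q ^ k * r) ≡ k
  go zero zero _ = refl
  go zero (suc k) bound = ⊥-elim (ℕ.≢-nonZero⁻¹ _ {{q^k*r≢0 (suc k)}} (ℕP.n≤0⇒n≡0 bound))
  go (suc f) k bound with q ∣? q ^ k * r
  go (suc f) zero bound | yes q∣r = ⊥-elim (q∤r (subst (q ∣_) (ℕP.*-identityˡ r) q∣r))
  go (suc f) (suc k) bound | yes _ = cong suc (trans (cong (valAux f q) quotient≡) (go f k bound′))
    where
    unfold : q ^ suc k * r ≡ q * (q ^ k * r)
    unfold = *-assoc q (q ^ k) r
    quotient≡ : q ^ suc k * r / q ≡ q ^ k * r
    quotient≡ = trans (cong (_/ q) unfold) (q*n/q≡n q (q ^ k * r))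
    bound′ : q ^ k * r ≤ f
    bound′ = ℕP.≤-pred (ℕP.<-≤-trans (n<q*n q _ {{_}} {{q^k*r≢0 k}}) (subst (_≤ suc f) unfold bound))
  go (suc f) zero bound | no _ = refl
  go (suc f) (suc k) bound | no q∤n = ⊥-elim (q∤n (subst (q ∣_) (sym (*-assoc q (q ^ k) r)) (m∣m*n (q ^ k * r))))

val[q^k*r]≡k : ∀ {q} .{{_ : NonTrivial q}} k {r} → ¬ q ∣ r → val q (q ^ k * r) ≡ k
val[q^k*r]≡k k q∤r = valAux[q^k*r]≡k _ k q∤r ℕP.≤-refl

factorOutPower : ∀ q .{{_ : NonTrivial q}} n .{{_ : NonZero n}} →
                 ∃₂ λ k r → q ^ k * r ≡ n × ¬ q ∣ r
factorOutPower q n = go n (<-wellFounded n)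
  where
  go : ∀ n .{{_ : NonZero n}} → Acc _<_ n → ∃₂ λ k r → q ^ k * r ≡ n × ¬ q ∣ r
  go n (acc rec) with q ∣? n
  ... | no q∤n = 0 , n , ℕP.*-identityˡ n , q∤n
  ... | yes (divides m refl) = peel (go m {{m≢0}} (rec (m<m*n m q {{m≢0}} (ℕ.nonTrivial⇒n>1 q))))
    where
    m≢0 : NonZero m
    m≢0 = ℕP.m*n≢0⇒m≢0 m
    peel : ∃₂ (λ k r → q ^ k * r ≡ m × ¬ q ∣ r) → ∃₂ λ k r → q ^ k * r ≡ m * q × ¬ q ∣ r
    peel (k , r , q^k*r≡m , q∤r) =
      suc k , r , trans (*-assoc q (q ^ k) r) (trans (cong (q *_) q^k*r≡m) (*-comm q m)) , q∤r

val[m*n]≡val[n] : ∀ {q} → Prime q → ∀ {m} n .{{_ : NonZero n}} → ¬ q ∣ m → val q (m * n) ≡ val q n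
val[m*n]≡val[n] {q} q-prime {m} n q∤m = fromDecomposition (factorOutPower q n)
  where
  instance
    q-nonTrivial : NonTrivial q
    q-nonTrivial = prime⇒nonTrivial q-prime
  regroup : ∀ m x r → m * (x * r) ≡ x * (m * r)
  regroup = solve-∀
  fromDecomposition : ∃₂ (λ k r → q ^ k * r ≡ n × ¬ q ∣ r) → val q (m * n) ≡ val q n
  fromDecomposition (k , r , refl , q∤r) =
    trans (cong (val q) (regroup m (q ^ k) r)) (trans (val[q^k*r]≡k k q∤m*r) (sym (val[q^k*r]≡k k q∤r)))
    where
    q∤m*r : ¬ q ∣ m * r
    q∤m*r q∣m*r with euclidsLemma m r q-prime q∣m*r
    ... | inj₁ q∣m = q∤m q∣m
    ... | inj₂ q∣r = q∤r q∣r

-- Prime powers, coprimality and gcds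

prime∤⇒coprime : ∀ {p n} → Prime p → ¬ p ∣ n → Coprime p n
prime∤⇒coprime p-prime p∤n (d∣p , d∣n) with prime⇒irreducible p-prime d∣p
... | inj₁ d≡1 = d≡1
... | inj₂ refl = ⊥-elim (p∤n d∣n)

∣p^n⇒≡p^j : ∀ {p} → Prime p → ∀ n {d} → d ∣ p ^ n → ∃ λ j → d ≡ p ^ j
∣p^n⇒≡p^j p-prime zero d∣1 = 0 , ∣1⇒≡1 d∣1
∣p^n⇒≡p^j {p} p-prime (suc n) {d} d∣p^n with p ∣? d
... | yes (divides d′ refl) = lift (∣p^n⇒≡p^j p-prime n (*-cancelˡ-∣ p {{prime⇒nonZero p-prime}} p*d′∣p*p^n))
  where
  p*d′∣p*p^n : p * d′ ∣ p * p ^ n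
  p*d′∣p*p^n = subst (_∣ p * p ^ n) (*-comm d′ p) d∣p^n
  lift : ∃ (λ j → d′ ≡ p ^ j) → ∃ λ j → d′ * p ≡ p ^ j
  lift (j , refl) = suc j , *-comm (p ^ j) p
... | no p∤d = ∣p^n⇒≡p^j p-prime n (coprime-divisor (Coprime.sym (prime∤⇒coprime p-prime p∤d)) d∣p^n)

p^i∣p^j⊎p^j∣p^i : ∀ p i j → p ^ i ∣ p ^ j ⊎ p ^ j ∣ p ^ i
p^i∣p^j⊎p^j∣p^i p zero j = inj₁ (1∣ (p ^ j))
p^i∣p^j⊎p^j∣p^i p (suc i) zero = inj₂ (1∣ (p ^ suc i))
p^i∣p^j⊎p^j∣p^i p (suc i) (suc j) with p^i∣p^j⊎p^j∣p^i p i j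
... | inj₁ p^i∣p^j = inj₁ (*-monoʳ-∣ p p^i∣p^j)
... | inj₂ p^j∣p^i = inj₂ (*-monoʳ-∣ p p^j∣p^i)

prime∤⇒coprime-^ : ∀ {p n} → Prime p → ¬ p ∣ n → ∀ k → Coprime (p ^ k) n
prime∤⇒coprime-^ p-prime p∤n k (d∣p^k , d∣n) with ∣p^n⇒≡p^j p-prime k d∣p^k
... | zero , d≡1 = d≡1
... | suc j , refl = ⊥-elim (p∤n (∣-trans (m∣m*n _) d∣n))

coprime-∣ : ∀ {m n m′ n′} → Coprime m n → m′ ∣ m → n′ ∣ n → Coprime m′ n′
coprime-∣ m⊥n m′∣m n′∣n (d∣m′ , d∣n′) = m⊥n (∣-trans d∣m′ m′∣m , ∣-trans d∣n′ n′∣n)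

coprime-*ˡ : ∀ {m n o} → Coprime m o → Coprime n o → Coprime (m * n) o
coprime-*ˡ {m} m⊥o n⊥o (d∣m*n , d∣o) = n⊥o (coprime-divisor d⊥m d∣m*n , d∣o)
  where
  d⊥m : Coprime _ m
  d⊥m (e∣d , e∣m) = m⊥o (e∣m , ∣-trans e∣d d∣o)

coprime⇒*-∣ : ∀ {m n k} → Coprime m n → m ∣ k → n ∣ k → m * n ∣ k
coprime⇒*-∣ {m} {n} m⊥n (divides q refl) n∣q*m =
  subst (m * n ∣_) (*-comm m q) (*-monoʳ-∣ m (coprime-divisor (Coprime.sym m⊥n) (subst (n ∣_) (*-comm q m) n∣q*m)))

gcd[c,m*n]∣gcd[c,m]*gcd[c,n] : ∀ c m n → gcd c (m * n) ∣ gcd c m * gcd c n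
gcd[c,m*n]∣gcd[c,m]*gcd[c,n] c m n = subst (g ∣_) (sym (c*gcd[m,n]≡gcd[cm,cn] (gcd c m) c n))
  (gcd-greatest (∣n⇒∣m*n (gcd c m) g∣c) (subst (g ∣_) (*-comm n (gcd c m)) g∣n*gcd[c,m]))
  where
  g : ℕ
  g = gcd c (m * n)
  g∣c : g ∣ c
  g∣c = gcd[m,n]∣m c (m * n)
  g∣n*gcd[c,m] : g ∣ n * gcd c m
  g∣n*gcd[c,m] = subst (g ∣_) (sym (c*gcd[m,n]≡gcd[cm,cn] n c m))
    (gcd-greatest (∣n⇒∣m*n n g∣c) (subst (g ∣_) (*-comm m n) (gcd[m,n]∣n c (m * n))))

gcd[c,m]*gcd[c,n]∣gcd[c,m*n] : ∀ c {m n} → Coprime m n → gcd c m * gcd c n ∣ gcd c (m * n)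
gcd[c,m]*gcd[c,n]∣gcd[c,m*n] c {m} {n} m⊥n = gcd-greatest
  (coprime⇒*-∣ (coprime-∣ m⊥n (gcd[m,n]∣n c m) (gcd[m,n]∣n c n)) (gcd[m,n]∣m c m) (gcd[m,n]∣m c n))
  (*-pres-∣ (gcd[m,n]∣n c m) (gcd[m,n]∣n c n))

gcd[m*k,n]≡m : ∀ {m k n} → m ∣ n → Coprime k n → gcd (m * k) n ≡ m
gcd[m*k,n]≡m {m} {k} {n} m∣n k⊥n = ∣-antisym
  (coprime-divisor g⊥k (subst (gcd (m * k) n ∣_) (*-comm m k) (gcd[m,n]∣m (m * k) n)))
  (gcd-greatest (m∣m*n k) m∣n)
  where
  g⊥k : Coprime (gcd (m * k) n) k
  g⊥k = Coprime.sym (coprime-∣ k⊥n ∣-refl (gcd[m,n]∣n (m * k) n))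

SmallGcd LargeGcd : ℕ → ℕ → Set
SmallGcd c n = gcd c n * gcd c n ∣ n
LargeGcd c n = n ∣ gcd c n * gcd c n

[m*n]²≡m²*n² : ∀ m n → (m * n) * (m * n) ≡ (m * m) * (n * n)
[m*n]²≡m²*n² = solve-∀

*-pres-∣² : ∀ {m n} → m ∣ n → m * m ∣ n * n
*-pres-∣² m∣n = *-pres-∣ m∣n m∣n

smallGcd-* : ∀ {c m n} → SmallGcd c m → SmallGcd c n → SmallGcd c (m * n)
smallGcd-* {c} {m} {n} small-m small-n = ∣-trans
  (subst (gcd c (m * n) * gcd c (m * n) ∣_) ([m*n]²≡m²*n² (gcd c m) (gcd c n))
         (*-pres-∣² (gcd[c,m*n]∣gcd[c,m]*gcd[c,n] c m n)))
  (*-pres-∣ small-m small-n)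

largeGcd-* : ∀ {c m n} → Coprime m n → LargeGcd c m → LargeGcd c n → LargeGcd c (m * n)
largeGcd-* {c} {m} {n} m⊥n large-m large-n = ∣-trans
  (*-pres-∣ large-m large-n)
  (subst (_∣ gcd c (m * n) * gcd c (m * n)) ([m*n]²≡m²*n² (gcd c m) (gcd c n))
         (*-pres-∣² (gcd[c,m]*gcd[c,n]∣gcd[c,m*n] c m⊥n)))

k*g∣g*g⇒k*k∣k*g : ∀ k g .{{_ : NonZero g}} → k * g ∣ g * g → k * k ∣ k * g
k*g∣g*g⇒k*k∣k*g k g k*g∣g*g = *-monoʳ-∣ k (*-cancelʳ-∣ g k*g∣g*g)

factors-of-prime-power-comparable : ∀ {p} → Prime p → ∀ n {g h} → h * g ≡ p ^ n → g ∣ h ⊎ h ∣ g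
factors-of-prime-power-comparable p-prime n {g} {h} h*g≡p^n
  with ∣p^n⇒≡p^j p-prime n (divides h (sym h*g≡p^n))
     | ∣p^n⇒≡p^j p-prime n (divides g (trans (sym h*g≡p^n) (*-comm h g)))
... | i , refl | j , refl = p^i∣p^j⊎p^j∣p^i _ i j

smallGcd⊎largeGcd-^ : ∀ c {p} → Prime p → ∀ n → SmallGcd c (p ^ n) ⊎ LargeGcd c (p ^ n)
smallGcd⊎largeGcd-^ c {p} p-prime n = compare (gcd[m,n]∣n c (p ^ n))
  where
  g : ℕ
  g = gcd c (p ^ n)
  compare : g ∣ p ^ n → SmallGcd c (p ^ n) ⊎ LargeGcd c (p ^ n)
  compare (divides h p^n≡h*g) with factors-of-prime-power-comparable p-prime n {g} {h} (sym p^n≡h*g)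
  ... | inj₁ g∣h = inj₁ (subst (g * g ∣_) (sym p^n≡h*g) (*-monoˡ-∣ g g∣h))
  ... | inj₂ h∣g = inj₂ (subst (_∣ g * g) (sym p^n≡h*g) (*-monoˡ-∣ g h∣g))

prime∣⇒∤-coprime : ∀ {q m n} → Prime q → Coprime m n → q ∣ n → ¬ q ∣ m
prime∣⇒∤-coprime q-prime m⊥n q∣n q∣m = ℕ.nonTrivial⇒≢1 {{prime⇒nonTrivial q-prime}} (m⊥n (q∣m , q∣n))

NS-cong : ∀ {N N′} S → All (λ q → val q N ≡ val q N′) S → NS N S ≡ NS N′ S
NS-cong [] [] = refl
NS-cong {N} {N′} (q ∷ S) (vq≡ ∷ vS≡) = cong₂ _*_ (cong (q ^_) vq≡) (NS-cong {N} {N′} S vS≡)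

NS[m*n]≡NS[n] : ∀ {m n} .{{_ : NonZero n}} → Coprime m n → ∀ {S} → IsSubsetPN n S → NS (m * n) S ≡ NS n S
NS[m*n]≡NS[n] {m} {n} m⊥n {S} (_ , S⊆𝒫n) =
  NS-cong {m * n} {n} S (All.map (λ (q-prime , q∣n) → val[m*n]≡val[n] q-prime n (prime∣⇒∤-coprime q-prime m⊥n q∣n)) S⊆𝒫n)

-- Splitting N according to c

record Splitting (c N : ℕ) : Set where
  field
    S : List ℕ
    S⊆𝒫N : IsSubsetPN N S
    B : ℕ
    NS*B≡N : NS N S * B ≡ N
    NS⊥B : Coprime (NS N S) B
    smallGcd : SmallGcd c (NS N S)
    largeGcd : LargeGcd c B

mkSplitting : ∀ {c N} S → IsSubsetPN N S → ∀ {A} → NS N S ≡ A → ∀ B →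
              A * B ≡ N → Coprime A B → SmallGcd c A → LargeGcd c B → Splitting c N
mkSplitting S S⊆𝒫N refl B A*B≡N A⊥B small large = record
  { S = S ; S⊆𝒫N = S⊆𝒫N ; B = B ; NS*B≡N = A*B≡N ; NS⊥B = A⊥B ; smallGcd = small ; largeGcd = large }

splitting[1] : ∀ c → Splitting c 1
splitting[1] c = mkSplitting [] (AllPairs.[] , []) refl 1 refl (Coprime.1-coprimeTo 1)
  (subst (λ g → g * g ∣ 1) (sym (gcd-zeroʳ c)) ∣-refl) (1∣ _)

splitting-extend : ∀ {c p N′} .{{_ : NonZero N′}} → Prime p → ¬ p ∣ N′ → ∀ n →
                   Splitting c N′ → Splitting c (p ^ suc n * N′)
splitting-extend {c} {p} {N′} p-prime p∤N′ n split = extend (smallGcd⊎largeGcd-^ c p-prime (suc n))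
  where
  open Splitting split renaming (S⊆𝒫N to S⊆𝒫N′)
  P A : ℕ
  P = p ^ suc n
  A = NS N′ S
  P⊥N′ : Coprime P N′
  P⊥N′ = prime∤⇒coprime-^ p-prime p∤N′ (suc n)
  P⊥A : Coprime P A
  P⊥A = coprime-∣ P⊥N′ ∣-refl (divides B (trans (sym NS*B≡N) (*-comm A B)))
  P⊥B : Coprime P B
  P⊥B = coprime-∣ P⊥N′ ∣-refl (divides A (sym NS*B≡N))
  NS≡A : NS (P * N′) S ≡ A
  NS≡A = NS[m*n]≡NS[n] P⊥N′ S⊆𝒫N′
  S⊆𝒫N : All (λ q → Prime q × q ∣ P * N′) S
  S⊆𝒫N = All.map (λ (q-prime , q∣N′) → q-prime , ∣n⇒∣m*n P q∣N′) (proj₂ S⊆𝒫N′)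
  extend : SmallGcd c P ⊎ LargeGcd c P → Splitting c (P * N′)
  extend (inj₁ small-P) =
    mkSplitting (p ∷ S) (p∉S AllPairs.∷ proj₁ S⊆𝒫N′ , (p-prime , ∣m⇒∣m*n N′ (m∣m*n (p ^ n))) ∷ S⊆𝒫N) NS≡P*A B
      (trans (*-assoc P A B) (cong (P *_) NS*B≡N)) (coprime-*ˡ P⊥B NS⊥B) (smallGcd-* {c} small-P smallGcd) largeGcd
    where
    NS≡P*A : p ^ val p (P * N′) * NS (P * N′) S ≡ P * A
    NS≡P*A = cong₂ (λ v A → p ^ v * A) (val[q^k*r]≡k {{prime⇒nonTrivial p-prime}} (suc n) p∤N′) NS≡A
    p∉S : All (λ q → ¬ p ≡ q) S
    p∉S = All.map (λ { (_ , q∣N′) refl → p∤N′ q∣N′ }) (proj₂ S⊆𝒫N′)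
  extend (inj₂ large-P) =
    mkSplitting S (proj₁ S⊆𝒫N′ , S⊆𝒫N) NS≡A (P * B)
      (trans (rearrange A P B) (cong (P *_) NS*B≡N)) (Coprime.sym (coprime-*ˡ P⊥A (Coprime.sym NS⊥B))) smallGcd
      (largeGcd-* {c} P⊥B large-P largeGcd)
    where
    rearrange : ∀ A P B → A * (P * B) ≡ P * (A * B)
    rearrange = solve-∀

splitting : ∀ c N .{{_ : NonZero N}} → Splitting c N
splitting c N = go N (<-wellFounded N)
  where
  go : ∀ N .{{_ : NonZero N}} → Acc _<_ N → Splitting c N
  go N (acc rec) = fromFactorisation (factorise N)
    where
    fromPower : ∀ {p} → Prime p → p ∣ N → ∃₂ (λ k N′ → p ^ k * N′ ≡ N × ¬ p ∣ N′) → Splitting c N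
    fromPower {p} p-prime p∣N (zero , N′ , p^0*N′≡N , p∤N′) =
      ⊥-elim (p∤N′ (subst (p ∣_) (trans (sym p^0*N′≡N) (ℕP.*-identityˡ N′)) p∣N))
    fromPower {p} p-prime p∣N (suc n , N′ , P*N′≡N , p∤N′) =
      subst (Splitting c) P*N′≡N (splitting-extend p-prime p∤N′ n (go N′ (rec N′<N)))
      where
      instance
        N′≢0 : NonZero N′
        N′≢0 = ∤⇒≢0 p∤N′
      N′<N : N′ < N
      N′<N = subst (N′ <_) (trans (*-comm N′ (p ^ suc n)) P*N′≡N)
        (m<m*n N′ (p ^ suc n) (ℕP.^-monoʳ-< p (ℕ.nonTrivial⇒n>1 p {{prime⇒nonTrivial p-prime}}) {0} {suc n} (s≤s z≤n)))
    fromFactorisation : PrimeFactorisation N → Splitting c N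
    fromFactorisation record { factors = [] ; isFactorisation = N≡1 } = subst (Splitting c) (sym N≡1) (splitting[1] c)
    fromFactorisation record { factors = p ∷ ps ; isFactorisation = N≡p*∏ps ; factorsPrime = p-prime ∷ _ } =
      fromPower p-prime (subst (p ∣_) (sym N≡p*∏ps) (m∣m*n _)) (factorOutPower p {{prime⇒nonTrivial p-prime}} N)

-- Bézout identities and the first column of Wτ

∣i∣≡±i : ∀ i → ∃ λ s → + ℤ.∣ i ∣ ≡ s ℤ.* i
∣i∣≡±i i with ℤP.+∣i∣≡i⊎+∣i∣≡-i i
... | inj₁ ∣i∣≡i = 1ℤ , trans ∣i∣≡i (sym (ℤP.*-identityˡ i))
... | inj₂ ∣i∣≡-i = ℤ.-1ℤ , trans ∣i∣≡-i (sym (ℤP.-1*i≡-i i))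

bézout-ℕ : ∀ m n → ∃₂ λ u v → + gcd m n ≡ u ℤ.* + m ℤ.+ v ℤ.* + n
bézout-ℕ m n = fromIdentity (Bézout.identity (gcd-GCD m n))
  where
  g : ℕ
  g = gcd m n
  pos-affine : ∀ y n′ x m′ → g + y * n′ ≡ x * m′ → + g ℤ.+ + y ℤ.* + n′ ≡ + x ℤ.* + m′
  pos-affine y n′ x m′ eq = begin
    + g ℤ.+ + y ℤ.* + n′  ≡⟨ cong (λ z → + g ℤ.+ z) (ℤP.pos-* y n′) ⟨
    + g ℤ.+ + (y * n′)    ≡⟨ ℤP.pos-+ g (y * n′) ⟨
    + (g + y * n′)        ≡⟨ cong +_ eq ⟩
    + (x * m′)            ≡⟨ ℤP.pos-* x m′ ⟩
    + x ℤ.* + m′          ∎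
    where open ≡-Reasoning
  unshift : ∀ g y n → g ≡ (g ℤ.+ y ℤ.* n) ℤ.+ (ℤ.- y) ℤ.* n
  unshift = ℤRing.solve-∀
  fromIdentity : Bézout.Identity g m n → ∃₂ λ u v → + g ≡ u ℤ.* + m ℤ.+ v ℤ.* + n
  fromIdentity (Bézout.+- x y g+y*n≡x*m) =
    + x , ℤ.- + y , trans (unshift (+ g) (+ y) (+ n)) (cong (ℤ._+ (ℤ.- + y) ℤ.* + n) (pos-affine y n x m g+y*n≡x*m))
  fromIdentity (Bézout.-+ x y g+x*m≡y*n) =
    ℤ.- + x , + y , trans (unshift (+ g) (+ x) (+ m))
                          (trans (cong (ℤ._+ (ℤ.- + x) ℤ.* + m) (pos-affine x m y n g+x*m≡y*n)) (ℤP.+-comm (+ y ℤ.* + n) ((ℤ.- + x) ℤ.* + m)))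

bézout : ∀ i j → ∃₂ λ u v → + gcd ℤ.∣ i ∣ ℤ.∣ j ∣ ≡ u ℤ.* i ℤ.+ v ℤ.* j
bézout i j with bézout-ℕ ℤ.∣ i ∣ ℤ.∣ j ∣ | ∣i∣≡±i i | ∣i∣≡±i j
... | u , v , g≡u∣i∣+v∣j∣ | s , ∣i∣≡s*i | t , ∣j∣≡t*j =
  u ℤ.* s , v ℤ.* t , trans g≡u∣i∣+v∣j∣ (trans (cong₂ (λ i′ j′ → u ℤ.* i′ ℤ.+ v ℤ.* j′) ∣i∣≡s*i ∣j∣≡t*j) (regroup u s i v t j))
  where
  regroup : ∀ u s i v t j → u ℤ.* (s ℤ.* i) ℤ.+ v ℤ.* (t ℤ.* j) ≡ u ℤ.* s ℤ.* i ℤ.+ v ℤ.* t ℤ.* j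
  regroup = ℤRing.solve-∀

coprime⇒bézout : ∀ {i j} → ℤCoprime.Coprime i j → ∃₂ λ u v → u ℤ.* i ℤ.+ v ℤ.* j ≡ 1ℤ
coprime⇒bézout {i} {j} i⊥j with bézout i j
... | u , v , g≡u*i+v*j = u , v , trans (sym g≡u*i+v*j) (cong +_ (coprime⇒gcd≡1 i⊥j))

∣e*h⇒∣e : ∀ {D e h} → h ≡ 1ℤ → D ℤ∣.∣ e ℤ.* h → D ℤ∣.∣ e
∣e*h⇒∣e {D} {e} h≡1 = subst (D ℤ∣.∣_) (trans (cong (e ℤ.*_) h≡1) (ℤP.*-identityʳ e))

-- A common divisor of X and Z divides A′a and A′c (apply the adjugate of W to Wτ), hence A′;
-- it then divides yc′, but A′ and yc′ are coprime by the two Bézout relations.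
primitive-first-column : ∀ A′ M B x y a b d c′ u w →
  A′ ℤ.* M ℤ.* x ℤ.- B ℤ.* y ≡ 1ℤ → u ℤ.* c′ ℤ.+ w ℤ.* A′ ≡ 1ℤ → a ℤ.* d ℤ.- b ℤ.* (c′ ℤ.* M) ≡ 1ℤ →
  ℤCoprime.Coprime (A′ ℤ.* x ℤ.* a ℤ.+ y ℤ.* c′) (A′ ℤ.* (B ℤ.* a ℤ.+ c′ ℤ.* M))
primitive-first-column A′ M B x y a b d c′ u w h₁ h₂ h₃ {i} (i∣X , i∣Z) =
  ∣1⇒≡1 (ℤ∣.∣⇒∣ᵤ (subst (D ℤ∣.∣_) (cong₂ ℤ._*_ h₁ h₂) D∣h₁*h₂))
  where
  X Z D : ℤ
  X = A′ ℤ.* x ℤ.* a ℤ.+ y ℤ.* c′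
  Z = A′ ℤ.* (B ℤ.* a ℤ.+ c′ ℤ.* M)
  D = + i
  D∣X : D ℤ∣.∣ X
  D∣X = ℤ∣.∣ᵤ⇒∣ i∣X
  D∣Z : D ℤ∣.∣ Z
  D∣Z = ℤ∣.∣ᵤ⇒∣ i∣Z
  adj₁ : ∀ A′ M B x y a c′ → A′ ℤ.* a ℤ.* (A′ ℤ.* M ℤ.* x ℤ.- B ℤ.* y)
       ≡ A′ ℤ.* M ℤ.* (A′ ℤ.* x ℤ.* a ℤ.+ y ℤ.* c′) ℤ.- y ℤ.* (A′ ℤ.* (B ℤ.* a ℤ.+ c′ ℤ.* M))
  adj₁ = ℤRing.solve-∀
  adj₂ : ∀ A′ M B x y a c′ → A′ ℤ.* (c′ ℤ.* M) ℤ.* (A′ ℤ.* M ℤ.* x ℤ.- B ℤ.* y)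
       ≡ A′ ℤ.* M ℤ.* x ℤ.* (A′ ℤ.* (B ℤ.* a ℤ.+ c′ ℤ.* M)) ℤ.- A′ ℤ.* M ℤ.* B ℤ.* (A′ ℤ.* x ℤ.* a ℤ.+ y ℤ.* c′)
  adj₂ = ℤRing.solve-∀
  det₃ : ∀ A′ M a b d c′ → A′ ℤ.* (a ℤ.* d ℤ.- b ℤ.* (c′ ℤ.* M)) ≡ A′ ℤ.* a ℤ.* d ℤ.- b ℤ.* (A′ ℤ.* (c′ ℤ.* M))
  det₃ = ℤRing.solve-∀
  bézout₁₂ : ∀ A′ M B x y c′ u w → (A′ ℤ.* M ℤ.* x ℤ.- B ℤ.* y) ℤ.* (u ℤ.* c′ ℤ.+ w ℤ.* A′)
           ≡ (M ℤ.* x ℤ.* u ℤ.* c′ ℤ.+ M ℤ.* x ℤ.* w ℤ.* A′ ℤ.- B ℤ.* y ℤ.* w) ℤ.* A′ ℤ.- B ℤ.* u ℤ.* (y ℤ.* c′)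
  bézout₁₂ = ℤRing.solve-∀
  D∣A′a : D ℤ∣.∣ A′ ℤ.* a
  D∣A′a = ∣e*h⇒∣e h₁ (subst (D ℤ∣.∣_) (sym (adj₁ A′ M B x y a c′))
    (ℤ∣.∣m∣n⇒∣m-n (ℤ∣.∣n⇒∣m*n (A′ ℤ.* M) D∣X) (ℤ∣.∣n⇒∣m*n y D∣Z)))
  D∣A′c : D ℤ∣.∣ A′ ℤ.* (c′ ℤ.* M)
  D∣A′c = ∣e*h⇒∣e h₁ (subst (D ℤ∣.∣_) (sym (adj₂ A′ M B x y a c′))
    (ℤ∣.∣m∣n⇒∣m-n (ℤ∣.∣n⇒∣m*n (A′ ℤ.* M ℤ.* x) D∣Z) (ℤ∣.∣n⇒∣m*n (A′ ℤ.* M ℤ.* B) D∣X)))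
  D∣A′ : D ℤ∣.∣ A′
  D∣A′ = ∣e*h⇒∣e h₃ (subst (D ℤ∣.∣_) (sym (det₃ A′ M a b d c′))
    (ℤ∣.∣m∣n⇒∣m-n (ℤ∣.∣m⇒∣m*n d D∣A′a) (ℤ∣.∣n⇒∣m*n b D∣A′c)))
  D∣yc′ : D ℤ∣.∣ y ℤ.* c′
  D∣yc′ = ℤ∣.∣m+n∣m⇒∣n D∣X (ℤ∣.∣m⇒∣m*n a (ℤ∣.∣m⇒∣m*n x D∣A′))
  D∣h₁*h₂ : D ℤ∣.∣ (A′ ℤ.* M ℤ.* x ℤ.- B ℤ.* y) ℤ.* (u ℤ.* c′ ℤ.+ w ℤ.* A′)
  D∣h₁*h₂ = subst (D ℤ∣.∣_) (sym (bézout₁₂ A′ M B x y c′ u w))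
    (ℤ∣.∣m∣n⇒∣m-n (ℤ∣.∣n⇒∣m*n (M ℤ.* x ℤ.* u ℤ.* c′ ℤ.+ M ℤ.* x ℤ.* w ℤ.* A′ ℤ.- B ℤ.* y ℤ.* w) D∣A′) (ℤ∣.∣n⇒∣m*n (B ℤ.* u) D∣yc′))

gcd[B*a+c,m*B]≡gcd[c,B] : ∀ {m B} a b {c} d → Coprime m B → m ∣ ℤ.∣ c ∣ → a ℤ.* d ℤ.- b ℤ.* c ≡ 1ℤ →
                          gcd ℤ.∣ + B ℤ.* a ℤ.+ c ∣ (m * B) ≡ gcd ℤ.∣ c ∣ B
gcd[B*a+c,m*B]≡gcd[c,B] {m} {B} a b {c} d m⊥B m∣c ad-bc≡1 = ∣-antisym
  (gcd-greatest H∣c H∣B)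
  (gcd-greatest (ℤ∣.∣⇒∣ᵤ G∣z) (∣n⇒∣m*n m (gcd[m,n]∣n ℤ.∣ c ∣ B)))
  where
  z : ℤ
  z = + B ℤ.* a ℤ.+ c
  G H : ℕ
  G = gcd ℤ.∣ c ∣ B
  H = gcd ℤ.∣ z ∣ (m * B)
  G∣z : + G ℤ∣.∣ z
  G∣z = ℤ∣.∣m∣n⇒∣m+n (ℤ∣.∣m⇒∣m*n a (ℤ∣.∣ᵤ⇒∣ {+ G} {+ B} (gcd[m,n]∣n ℤ.∣ c ∣ B))) (ℤ∣.∣ᵤ⇒∣ {+ G} {c} (gcd[m,n]∣m ℤ.∣ c ∣ B))
  H∣z : + H ℤ∣.∣ z
  H∣z = ℤ∣.∣ᵤ⇒∣ (gcd[m,n]∣m ℤ.∣ z ∣ (m * B))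
  H⊥m : Coprime H m
  H⊥m {j} (j∣H , j∣m) = ∣1⇒≡1 (ℤ∣.∣⇒∣ᵤ j∣1)
    where
    j∣c : + j ℤ∣.∣ c
    j∣c = ℤ∣.∣ᵤ⇒∣ (∣-trans j∣m m∣c)
    j∣Ba : + j ℤ∣.∣ + B ℤ.* a
    j∣Ba = ℤ∣.∣m+n∣n⇒∣m (ℤ∣.∣-trans (ℤ∣.∣ᵤ⇒∣ j∣H) H∣z) j∣c
    j∣a : + j ℤ∣.∣ a
    j∣a = ℤ∣.∣ᵤ⇒∣ (coprime-divisor (coprime-∣ m⊥B j∣m ∣-refl) (subst (j ∣_) (ℤP.abs-* (+ B) a) (ℤ∣.∣⇒∣ᵤ j∣Ba)))
    j∣1 : + j ℤ∣.∣ 1ℤ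
    j∣1 = subst (+ j ℤ∣.∣_) ad-bc≡1 (ℤ∣.∣m∣n⇒∣m-n (ℤ∣.∣m⇒∣m*n d j∣a) (ℤ∣.∣n⇒∣m*n b j∣c))
  H∣B : H ∣ B
  H∣B = coprime-divisor H⊥m (gcd[m,n]∣n ℤ.∣ z ∣ (m * B))
  H∣c : H ∣ ℤ.∣ c ∣
  H∣c = ℤ∣.∣⇒∣ᵤ (ℤ∣.∣m+n∣m⇒∣n H∣z (ℤ∣.∣m⇒∣m*n a (ℤ∣.∣ᵤ⇒∣ {+ H} {+ B} H∣B)))

-- The factorisation over ℚ

mat-cong : ∀ {A : Set} {a b c d a′ b′ c′ d′ : A} → a ≡ a′ → b ≡ b′ → c ≡ c′ → d ≡ d′ → mat a b c d ≡ mat a′ b′ c′ d′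
mat-cong refl refl refl refl = refl

detℤ-mulℤ : ∀ m n → detℤ (mulℤ m n) ≡ detℤ m ℤ.* detℤ n
detℤ-mulℤ (mat a b c d) (mat a′ b′ c′ d′) = expand a b c d a′ b′ c′ d′
  where
  expand : ∀ a b c d a′ b′ c′ d′ →
    (a ℤ.* a′ ℤ.+ b ℤ.* c′) ℤ.* (c ℤ.* b′ ℤ.+ d ℤ.* d′) ℤ.- (a ℤ.* b′ ℤ.+ b ℤ.* d′) ℤ.* (c ℤ.* a′ ℤ.+ d ℤ.* c′)
    ≡ (a ℤ.* d ℤ.- b ℤ.* c) ℤ.* (a′ ℤ.* d′ ℤ.- b′ ℤ.* c′)
  expand = ℤRing.solve-∀

ℚ-ring : ACR.AlmostCommutativeRing 0ℓ 0ℓ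
ℚ-ring = ACR.fromCommutativeRing ℚP.+-*-commutativeRing is-zero
  where
  is-zero : ∀ p → Maybe (0ℚ ≡ p)
  is-zero p with 0ℚ ℚP.≟ p
  ... | yes 0≡p = just 0≡p
  ... | no _ = nothing

fromℚᵘ-homo-* : ∀ p q → fromℚᵘ (p ℚᵘ.* q) ≡ fromℚᵘ p ℚ.* fromℚᵘ q
fromℚᵘ-homo-* p q = ℚP.toℚᵘ-injective (ℚᵘP.≃-trans (ℚP.toℚᵘ-fromℚᵘ (p ℚᵘ.* q))
  (ℚᵘP.≃-trans (ℚᵘP.*-cong (ℚᵘP.≃-sym (ℚP.toℚᵘ-fromℚᵘ p)) (ℚᵘP.≃-sym (ℚP.toℚᵘ-fromℚᵘ q)))
               (ℚᵘP.≃-sym (ℚP.toℚᵘ-homo-* (fromℚᵘ p) (fromℚᵘ q)))))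

fromℚᵘ-homo-+ : ∀ p q → fromℚᵘ (p ℚᵘ.+ q) ≡ fromℚᵘ p ℚ.+ fromℚᵘ q
fromℚᵘ-homo-+ p q = ℚP.toℚᵘ-injective (ℚᵘP.≃-trans (ℚP.toℚᵘ-fromℚᵘ (p ℚᵘ.+ q))
  (ℚᵘP.≃-trans (ℚᵘP.+-cong (ℚᵘP.≃-sym (ℚP.toℚᵘ-fromℚᵘ p)) (ℚᵘP.≃-sym (ℚP.toℚᵘ-fromℚᵘ q)))
               (ℚᵘP.≃-sym (ℚP.toℚᵘ-homo-+ (fromℚᵘ p) (fromℚᵘ q)))))

-- ℤtoℚ i unfolds to fromℚᵘ (mkℚᵘ i 0), so the ring laws of ℤtoℚ come from those of fromℚᵘ.
ℤtoℚ-* : ∀ i j → ℤtoℚ (i ℤ.* j) ≡ ℤtoℚ i ℚ.* ℤtoℚ j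
ℤtoℚ-* i j = fromℚᵘ-homo-* (mkℚᵘ i 0) (mkℚᵘ j 0)

ℤtoℚ-+ : ∀ i j → ℤtoℚ (i ℤ.+ j) ≡ ℤtoℚ i ℚ.+ ℤtoℚ j
ℤtoℚ-+ i j = trans (cong ℤtoℚ (sym (cong₂ ℤ._+_ (ℤP.*-identityʳ i) (ℤP.*-identityʳ j))))
                   (fromℚᵘ-homo-+ (mkℚᵘ i 0) (mkℚᵘ j 0))

ℤtoℚ[n]*1/n≡1 : ∀ n .{{_ : NonZero n}} → ℤtoℚ (+ n) ℚ.* fracℚ 1ℤ n ≡ 1ℚ
ℤtoℚ[n]*1/n≡1 (suc n) = trans (sym (fromℚᵘ-homo-* (mkℚᵘ (+ suc n) 0) (mkℚᵘ 1ℤ n)))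
  (ℚP.fromℚᵘ-cong {mkℚᵘ (+ suc n) 0 ℚᵘ.* mkℚᵘ 1ℤ n} {mkℚᵘ 1ℤ 0} (*≡* cross))
  where
  cross : (+ suc n ℤ.* 1ℤ) ℤ.* 1ℤ ≡ 1ℤ ℤ.* + suc (n + 0)
  cross = trans (ℤP.*-identityʳ _) (trans (ℤP.*-identityʳ _)
                (sym (trans (ℤP.*-identityˡ _) (cong (λ k → + suc k) (ℕP.+-identityʳ n)))))

fracℚ[m,n]≡m*1/n : ∀ m n .{{_ : NonZero n}} → fracℚ (+ m) n ≡ ℤtoℚ (+ m) ℚ.* fracℚ 1ℤ n
fracℚ[m,n]≡m*1/n m (suc n) =
  trans (ℚP.fromℚᵘ-cong {mkℚᵘ (+ m) n} {mkℚᵘ (+ m) 0 ℚᵘ.* mkℚᵘ 1ℤ n} (*≡* cross))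
        (fromℚᵘ-homo-* (mkℚᵘ (+ m) 0) (mkℚᵘ 1ℤ n))
  where
  cross : + m ℤ.* + suc (n + 0) ≡ (+ m ℤ.* 1ℤ) ℤ.* + suc n
  cross = trans (cong (λ k → + m ℤ.* + suc k) (ℕP.+-identityʳ n)) (cong (ℤ._* + suc n) (sym (ℤP.*-identityʳ (+ m))))

first-column-entry : ∀ {M i} → M ℚ.* i ≡ 1ℚ → ∀ R S t →
  (R ℚ.* M ℚ.* 1ℚ ℚ.+ S ℚ.* 0ℚ) ℚ.* i ℚ.+ (R ℚ.* M ℚ.* t ℚ.+ S ℚ.* 1ℚ) ℚ.* 0ℚ ≡ R
first-column-entry {M} {i} M*i≡1 R S t = begin
  (R ℚ.* M ℚ.* 1ℚ ℚ.+ S ℚ.* 0ℚ) ℚ.* i ℚ.+ (R ℚ.* M ℚ.* t ℚ.+ S ℚ.* 1ℚ) ℚ.* 0ℚ  ≡⟨ normalise R M i S t ⟩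
  R ℚ.* (M ℚ.* i)                                                              ≡⟨ cong (R ℚ.*_) M*i≡1 ⟩
  R ℚ.* 1ℚ                                                                     ≡⟨ ℚP.*-identityʳ R ⟩
  R                                                                            ∎
  where
  open ≡-Reasoning
  normalise : ∀ R M i S t →
    (R ℚ.* M ℚ.* 1ℚ ℚ.+ S ℚ.* 0ℚ) ℚ.* i ℚ.+ (R ℚ.* M ℚ.* t ℚ.+ S ℚ.* 1ℚ) ℚ.* 0ℚ ≡ R ℚ.* (M ℚ.* i)
  normalise = RingSolver.solve-∀ ℚ-ring

second-column-entry : ∀ {M i} → M ℚ.* i ≡ 1ℚ → ∀ R S s e →
  (R ℚ.* M ℚ.* 1ℚ ℚ.+ S ℚ.* 0ℚ) ℚ.* 0ℚ ℚ.+ (R ℚ.* M ℚ.* (s ℚ.* i) ℚ.+ S ℚ.* 1ℚ) ℚ.* e ≡ (R ℚ.* s ℚ.+ S) ℚ.* e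
second-column-entry {M} {i} M*i≡1 R S s e = begin
  (R ℚ.* M ℚ.* 1ℚ ℚ.+ S ℚ.* 0ℚ) ℚ.* 0ℚ ℚ.+ (R ℚ.* M ℚ.* (s ℚ.* i) ℚ.+ S ℚ.* 1ℚ) ℚ.* e ≡⟨ normalise R M i S s e ⟩
  (R ℚ.* (M ℚ.* i) ℚ.* s ℚ.+ S) ℚ.* e                                                   ≡⟨ cong (λ w → (R ℚ.* w ℚ.* s ℚ.+ S) ℚ.* e) M*i≡1 ⟩
  (R ℚ.* 1ℚ ℚ.* s ℚ.+ S) ℚ.* e                                                          ≡⟨ cong (λ w → (w ℚ.* s ℚ.+ S) ℚ.* e) (ℚP.*-identityʳ R) ⟩
  (R ℚ.* s ℚ.+ S) ℚ.* e                                                                 ∎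
  where
  open ≡-Reasoning
  normalise : ∀ R M i S s e →
    (R ℚ.* M ℚ.* 1ℚ ℚ.+ S ℚ.* 0ℚ) ℚ.* 0ℚ ℚ.+ (R ℚ.* M ℚ.* (s ℚ.* i) ℚ.+ S ℚ.* 1ℚ) ℚ.* e ≡ (R ℚ.* (M ℚ.* i) ℚ.* s ℚ.+ S) ℚ.* e
  normalise = RingSolver.solve-∀ ℚ-ring

ℤtoℚ[d]*m/a≡1 : ∀ d m a .{{_ : NonZero a}} → d ℤ.* + m ≡ + a → ℤtoℚ d ℚ.* fracℚ (+ m) a ≡ 1ℚ
ℤtoℚ[d]*m/a≡1 d m a d*m≡a = begin
  ℤtoℚ d ℚ.* fracℚ (+ m) a                    ≡⟨ cong (ℤtoℚ d ℚ.*_) (fracℚ[m,n]≡m*1/n m a) ⟩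
  ℤtoℚ d ℚ.* (ℤtoℚ (+ m) ℚ.* fracℚ 1ℤ a)      ≡⟨ ℚP.*-assoc (ℤtoℚ d) (ℤtoℚ (+ m)) (fracℚ 1ℤ a) ⟨
  ℤtoℚ d ℚ.* ℤtoℚ (+ m) ℚ.* fracℚ 1ℤ a        ≡⟨ cong (ℚ._* fracℚ 1ℤ a) (trans (sym (ℤtoℚ-* d (+ m))) (cong ℤtoℚ d*m≡a)) ⟩
  ℤtoℚ (+ a) ℚ.* fracℚ 1ℤ a                   ≡⟨ ℤtoℚ[n]*1/n≡1 a ⟩
  1ℚ                                          ∎
  where open ≡-Reasoning

row-entry : ∀ R s S r D e → R ℤ.* s ℤ.+ S ≡ r ℤ.* D → ℤtoℚ D ℚ.* e ≡ 1ℚ →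
            (ℤtoℚ R ℚ.* ℤtoℚ s ℚ.+ ℤtoℚ S) ℚ.* e ≡ ℤtoℚ r
row-entry R s S r D e Rs+S≡rD D*e≡1 = begin
  (ℤtoℚ R ℚ.* ℤtoℚ s ℚ.+ ℤtoℚ S) ℚ.* e  ≡⟨ cong (ℚ._* e) (trans (ℤtoℚ-+ (R ℤ.* s) S) (cong (ℚ._+ ℤtoℚ S) (ℤtoℚ-* R s))) ⟨
  ℤtoℚ (R ℤ.* s ℤ.+ S) ℚ.* e            ≡⟨ cong (λ w → ℤtoℚ w ℚ.* e) Rs+S≡rD ⟩
  ℤtoℚ (r ℤ.* D) ℚ.* e                  ≡⟨ cong (ℚ._* e) (ℤtoℚ-* r D) ⟩
  ℤtoℚ r ℚ.* ℤtoℚ D ℚ.* e               ≡⟨ ℚP.*-assoc (ℤtoℚ r) (ℤtoℚ D) e ⟩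
  ℤtoℚ r ℚ.* (ℤtoℚ D ℚ.* e)             ≡⟨ cong (ℤtoℚ r ℚ.*_) D*e≡1 ⟩
  ℤtoℚ r ℚ.* 1ℚ                         ≡⟨ ℚP.*-identityʳ (ℤtoℚ r) ⟩
  ℤtoℚ r                                ∎
  where open ≡-Reasoning

shear-rows : ∀ X Y Z U P Q → X ℤ.* P ℤ.+ Q ℤ.* Z ≡ 1ℤ →
  (X ℤ.* ℤ.- (U ℤ.* Q ℤ.+ Y ℤ.* P) ℤ.+ Y ≡ ℤ.- Q ℤ.* (X ℤ.* U ℤ.- Y ℤ.* Z)) ×
  (Z ℤ.* ℤ.- (U ℤ.* Q ℤ.+ Y ℤ.* P) ℤ.+ U ≡ P ℤ.* (X ℤ.* U ℤ.- Y ℤ.* Z))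
shear-rows X Y Z U P Q XP+QZ≡1 =
  trans (cong (λ h → X ℤ.* ℤ.- (U ℤ.* Q ℤ.+ Y ℤ.* P) ℤ.+ h) (times-1 Y)) (x-row X Y Z U P Q) ,
  trans (cong (λ h → Z ℤ.* ℤ.- (U ℤ.* Q ℤ.+ Y ℤ.* P) ℤ.+ h) (times-1 U)) (z-row X Y Z U P Q)
  where
  times-1 : ∀ S → S ≡ S ℤ.* (X ℤ.* P ℤ.+ Q ℤ.* Z)
  times-1 S = sym (trans (cong (S ℤ.*_) XP+QZ≡1) (ℤP.*-identityʳ S))
  x-row : ∀ X Y Z U P Q → X ℤ.* ℤ.- (U ℤ.* Q ℤ.+ Y ℤ.* P) ℤ.+ Y ℤ.* (X ℤ.* P ℤ.+ Q ℤ.* Z) ≡ ℤ.- Q ℤ.* (X ℤ.* U ℤ.- Y ℤ.* Z)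
  x-row = ℤRing.solve-∀
  z-row : ∀ X Y Z U P Q → Z ℤ.* ℤ.- (U ℤ.* Q ℤ.+ Y ℤ.* P) ℤ.+ U ℤ.* (X ℤ.* P ℤ.+ Q ℤ.* Z) ≡ P ℤ.* (X ℤ.* U ℤ.- Y ℤ.* Z)
  z-row = ℤRing.solve-∀

-- t is chosen so that M·t = −(UQ + YP) ∈ ℤ; the second column of (XM Y; ZM U)·T(t) is then
-- (−Q, P)·(XU − YZ), and M·(XU − YZ) = A.
toℚ-factorisation : ∀ X Y Z U P Q M A .{{_ : NonZero M}} .{{_ : NonZero A}} →
  X ℤ.* + M ℤ.* U ℤ.- Y ℤ.* (Z ℤ.* + M) ≡ + A → X ℤ.* P ℤ.+ Q ℤ.* Z ≡ 1ℤ →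
  toℚ (mat X (ℤ.- Q) Z P) ≡
  mulℚ (mulℚ (toℚ (mat (X ℤ.* + M) Y (Z ℤ.* + M) U)) (Tmat (ℤtoℚ (ℤ.- (U ℤ.* Q ℤ.+ Y ℤ.* P)) ℚ.* fracℚ 1ℤ M)))
       (Dmat M A)
toℚ-factorisation X Y Z U P Q M A det≡A XP+QZ≡1 = begin
  toℚ (mat X (ℤ.- Q) Z P)
    ≡⟨ mat-cong (first-column-entry M*M⁻¹≡1 qX qY t)
                (trans (second-column-entry M*M⁻¹≡1 qX qY (ℤtoℚ s) e) (row-entry X s Y (ℤ.- Q) D e x-row D*e≡1))
                (first-column-entry M*M⁻¹≡1 qZ qU t)
                (trans (second-column-entry M*M⁻¹≡1 qZ qU (ℤtoℚ s) e) (row-entry Z s U P D e z-row D*e≡1)) ⟨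
  mulℚ (mulℚ (mat (qX ℚ.* qM) qY (qZ ℚ.* qM) qU) (Tmat t)) (Dmat M A)
    ≡⟨ cong (λ γ → mulℚ (mulℚ γ (Tmat t)) (Dmat M A)) (mat-cong (ℤtoℚ-* X (+ M)) (refl {x = qY}) (ℤtoℚ-* Z (+ M)) (refl {x = qU})) ⟨
  mulℚ (mulℚ (toℚ (mat (X ℤ.* + M) Y (Z ℤ.* + M) U)) (Tmat t)) (Dmat M A) ∎
  where
  open ≡-Reasoning
  s D : ℤ
  s = ℤ.- (U ℤ.* Q ℤ.+ Y ℤ.* P)
  D = X ℤ.* U ℤ.- Y ℤ.* Z
  qX qY qZ qU qM t e : ℚ
  qX = ℤtoℚ X
  qY = ℤtoℚ Y
  qZ = ℤtoℚ Z
  qU = ℤtoℚ U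
  qM = ℤtoℚ (+ M)
  t = ℤtoℚ s ℚ.* fracℚ 1ℤ M
  e = fracℚ (+ M) A
  M*M⁻¹≡1 : qM ℚ.* fracℚ 1ℤ M ≡ 1ℚ
  M*M⁻¹≡1 = ℤtoℚ[n]*1/n≡1 M
  D*e≡1 : ℤtoℚ D ℚ.* e ≡ 1ℚ
  D*e≡1 = ℤtoℚ[d]*m/a≡1 D M A (trans (factor X Y Z U (+ M)) det≡A)
    where
    factor : ∀ X Y Z U M → (X ℤ.* U ℤ.- Y ℤ.* Z) ℤ.* M ≡ X ℤ.* M ℤ.* U ℤ.- Y ℤ.* (Z ℤ.* M)
    factor = ℤRing.solve-∀
  x-row : X ℤ.* s ℤ.+ Y ≡ ℤ.- Q ℤ.* D
  x-row = proj₁ (shear-rows X Y Z U P Q XP+QZ≡1)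
  z-row : Z ℤ.* s ℤ.+ U ≡ P ℤ.* D
  z-row = proj₂ (shear-rows X Y Z U P Q XP+QZ≡1)

module Reduction (N : ℕ) {{N≢0 : NonZero N}} (a b c d : ℤ) (ad-bc≡1 : a ℤ.* d ℤ.- b ℤ.* c ≡ 1ℤ) where

  open Splitting (splitting ℤ.∣ c ∣ N) public using (S; S⊆𝒫N)
  open Splitting (splitting ℤ.∣ c ∣ N) using (B; NS*B≡N; NS⊥B; smallGcd; largeGcd)

  A M₁ A′ gB k M : ℕ
  A = NS N S
  M₁ = gcd ℤ.∣ c ∣ A
  A′ = quotient (gcd[m,n]∣n ℤ.∣ c ∣ A)
  gB = gcd ℤ.∣ c ∣ B
  k = quotient (gcd[m,n]∣n ℤ.∣ c ∣ B)
  M = M₁ * k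

  A≡A′*M₁ : A ≡ A′ * M₁
  A≡A′*M₁ = m∣n⇒n≡quotient*m (gcd[m,n]∣n ℤ.∣ c ∣ A)
  B≡k*gB : B ≡ k * gB
  B≡k*gB = m∣n⇒n≡quotient*m (gcd[m,n]∣n ℤ.∣ c ∣ B)

  instance
    A≢0 : NonZero A
    A≢0 = ℕP.m*n≢0⇒m≢0 A {{subst NonZero (sym NS*B≡N) N≢0}}
    B≢0 : NonZero B
    B≢0 = ℕP.m*n≢0⇒n≢0 A {{subst NonZero (sym NS*B≡N) N≢0}}
    M₁≢0 : NonZero M₁
    M₁≢0 = ≢-nonZero (gcd[m,n]≢0 ℤ.∣ c ∣ A (inj₂ (ℕ.≢-nonZero⁻¹ A)))
    gB≢0 : NonZero gB
    gB≢0 = ≢-nonZero (gcd[m,n]≢0 ℤ.∣ c ∣ B (inj₂ (ℕ.≢-nonZero⁻¹ B)))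
    k≢0 : NonZero k
    k≢0 = ℕP.m*n≢0⇒m≢0 k {{subst NonZero B≡k*gB B≢0}}
    M≢0 : NonZero M
    M≢0 = ℕP.m*n≢0 M₁ k

  M₁∣A : M₁ ∣ A
  M₁∣A = gcd[m,n]∣n ℤ.∣ c ∣ A
  k∣B : k ∣ B
  k∣B = quotient-∣ (gcd[m,n]∣n ℤ.∣ c ∣ B)

  M₁²∣A : M₁ * M₁ ∣ A
  M₁²∣A = smallGcd
  k²∣B : k * k ∣ B
  k²∣B = subst (k * k ∣_) (sym B≡k*gB) (k*g∣g*g⇒k*k∣k*g k gB (subst (_∣ gB * gB) B≡k*gB largeGcd))
  M²∣N : M * M ∣ N
  M²∣N = subst (M * M ∣_) NS*B≡N (subst (_∣ A * B) (sym ([m*n]²≡m²*n² M₁ k)) (*-pres-∣ M₁²∣A k²∣B))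
  M₁≡gcd[M,A] : M₁ ≡ gcd M A
  M₁≡gcd[M,A] = sym (gcd[m*k,n]≡m M₁∣A (coprime-∣ (Coprime.sym NS⊥B) k∣B ∣-refl))

  +A≡+A′*+M₁ : + A ≡ + A′ ℤ.* + M₁
  +A≡+A′*+M₁ = trans (cong +_ A≡A′*M₁) (ℤP.pos-* A′ M₁)
  +N≡+A′*+M₁*+B : + N ≡ + A′ ℤ.* + M₁ ℤ.* + B
  +N≡+A′*+M₁*+B = trans (cong +_ (sym NS*B≡N)) (trans (ℤP.pos-* A B) (cong (ℤ._* + B) +A≡+A′*+M₁))

  c′ : ℤ
  c′ = ℤ∣.quotient (ℤ∣.∣ᵤ⇒∣ {+ M₁} {c} (gcd[m,n]∣m ℤ.∣ c ∣ A))
  c≡c′*M₁ : c ≡ c′ ℤ.* + M₁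
  c≡c′*M₁ = ℤ∣._∣_.equality (ℤ∣.∣ᵤ⇒∣ {+ M₁} {c} (gcd[m,n]∣m ℤ.∣ c ∣ A))

  AB-bézout : ∃₂ λ x v → x ℤ.* + A ℤ.+ v ℤ.* + B ≡ 1ℤ
  AB-bézout = coprime⇒bézout NS⊥B

  x y : ℤ
  x = proj₁ AB-bézout
  y = ℤ.- proj₁ (proj₂ AB-bézout)
  Ax-By≡1 : + A ℤ.* x ℤ.- + B ℤ.* y ≡ 1ℤ
  Ax-By≡1 = trans (reorder (+ A) (+ B) x (proj₁ (proj₂ AB-bézout))) (proj₂ (proj₂ AB-bézout))
    where
    reorder : ∀ A B x v → A ℤ.* x ℤ.- B ℤ.* ℤ.- v ≡ x ℤ.* A ℤ.+ v ℤ.* B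
    reorder = ℤRing.solve-∀

  cA-bézout : ∃₂ λ u w → + M₁ ≡ u ℤ.* c ℤ.+ w ℤ.* + A
  cA-bézout = bézout c (+ A)

  u w : ℤ
  u = proj₁ cA-bézout
  w = proj₁ (proj₂ cA-bézout)
  uc′+wA′≡1 : u ℤ.* c′ ℤ.+ w ℤ.* + A′ ≡ 1ℤ
  uc′+wA′≡1 = ℤP.*-cancelʳ-≡ _ _ (+ M₁) (begin
    (u ℤ.* c′ ℤ.+ w ℤ.* + A′) ℤ.* + M₁           ≡⟨ distrib u c′ w (+ A′) (+ M₁) ⟩
    u ℤ.* (c′ ℤ.* + M₁) ℤ.+ w ℤ.* (+ A′ ℤ.* + M₁) ≡⟨ cong₂ (λ c A → u ℤ.* c ℤ.+ w ℤ.* A) c≡c′*M₁ +A≡+A′*+M₁ ⟨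
    u ℤ.* c ℤ.+ w ℤ.* + A                        ≡⟨ proj₂ (proj₂ cA-bézout) ⟨
    + M₁                                         ≡⟨ ℤP.*-identityˡ (+ M₁) ⟨
    1ℤ ℤ.* + M₁                                  ∎)
    where
    open ≡-Reasoning
    distrib : ∀ u c′ w A′ M₁ → (u ℤ.* c′ ℤ.+ w ℤ.* A′) ℤ.* M₁ ≡ u ℤ.* (c′ ℤ.* M₁) ℤ.+ w ℤ.* (A′ ℤ.* M₁)
    distrib = ℤRing.solve-∀

  τ W : Mat2 ℤ
  τ = mat a b c d
  W = mat (+ A ℤ.* x) y (+ N) (+ A)

  detW≡A : detℤ W ≡ + A
  detW≡A = begin
    + A ℤ.* x ℤ.* + A ℤ.- y ℤ.* + N                 ≡⟨ cong (λ N → + A ℤ.* x ℤ.* + A ℤ.- y ℤ.* N) +N≡+A*+B ⟩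
    + A ℤ.* x ℤ.* + A ℤ.- y ℤ.* (+ A ℤ.* + B)       ≡⟨ factor (+ A) (+ B) x y ⟩
    + A ℤ.* (+ A ℤ.* x ℤ.- + B ℤ.* y)              ≡⟨ cong (+ A ℤ.*_) Ax-By≡1 ⟩
    + A ℤ.* 1ℤ                                     ≡⟨ ℤP.*-identityʳ (+ A) ⟩
    + A                                            ∎
    where
    open ≡-Reasoning
    +N≡+A*+B : + N ≡ + A ℤ.* + B
    +N≡+A*+B = trans (cong +_ (sym NS*B≡N)) (ℤP.pos-* A B)
    factor : ∀ A B x y → A ℤ.* x ℤ.* A ℤ.- y ℤ.* (A ℤ.* B) ≡ A ℤ.* (A ℤ.* x ℤ.- B ℤ.* y)
    factor = ℤRing.solve-∀

  W∈𝒲 : IsAtkinLehner N S W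
  W∈𝒲 = subst (A ∣_) (sym (ℤP.abs-* (+ A) x)) (m∣m*n ℤ.∣ x ∣)
      , divides B (trans (sym NS*B≡N) (*-comm A B)) , ∣-refl , ∣-refl , detW≡A

  X Y Z U : ℤ
  X = + A′ ℤ.* x ℤ.* a ℤ.+ y ℤ.* c′
  Z = + A′ ℤ.* (+ B ℤ.* a ℤ.+ c)
  Y = + A ℤ.* x ℤ.* b ℤ.+ y ℤ.* d
  U = + N ℤ.* b ℤ.+ + A ℤ.* d

  W*τ≡ : mulℤ W τ ≡ mat (X ℤ.* + M₁) Y (Z ℤ.* + M₁) U
  W*τ≡ = mat-cong first refl second refl
    where
    first : + A ℤ.* x ℤ.* a ℤ.+ y ℤ.* c ≡ X ℤ.* + M₁
    first = trans (cong₂ (λ A c → A ℤ.* x ℤ.* a ℤ.+ y ℤ.* c) +A≡+A′*+M₁ c≡c′*M₁) (factor (+ A′) (+ M₁) x a y c′)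
      where
      factor : ∀ A′ M₁ x a y c′ → A′ ℤ.* M₁ ℤ.* x ℤ.* a ℤ.+ y ℤ.* (c′ ℤ.* M₁) ≡ (A′ ℤ.* x ℤ.* a ℤ.+ y ℤ.* c′) ℤ.* M₁
      factor = ℤRing.solve-∀
    second : + N ℤ.* a ℤ.+ + A ℤ.* c ≡ Z ℤ.* + M₁
    second = trans (cong₂ (λ N A → N ℤ.* a ℤ.+ A ℤ.* c) +N≡+A′*+M₁*+B +A≡+A′*+M₁) (factor (+ A′) (+ M₁) (+ B) a c)
      where
      factor : ∀ A′ M₁ B a c → A′ ℤ.* M₁ ℤ.* B ℤ.* a ℤ.+ A′ ℤ.* M₁ ℤ.* c ≡ A′ ℤ.* (B ℤ.* a ℤ.+ c) ℤ.* M₁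
      factor = ℤRing.solve-∀

  det[W*τ]≡A : X ℤ.* + M₁ ℤ.* U ℤ.- Y ℤ.* (Z ℤ.* + M₁) ≡ + A
  det[W*τ]≡A = begin
    detℤ (mat (X ℤ.* + M₁) Y (Z ℤ.* + M₁) U)   ≡⟨ cong detℤ W*τ≡ ⟨
    detℤ (mulℤ W τ)                           ≡⟨ detℤ-mulℤ W τ ⟩
    detℤ W ℤ.* detℤ τ                         ≡⟨ cong₂ ℤ._*_ detW≡A ad-bc≡1 ⟩
    + A ℤ.* 1ℤ                                ≡⟨ ℤP.*-identityʳ (+ A) ⟩
    + A                                       ∎
    where open ≡-Reasoning

  X⊥Z : ℤCoprime.Coprime X Z
  X⊥Z = subst (λ c → ℤCoprime.Coprime X (+ A′ ℤ.* (+ B ℤ.* a ℤ.+ c))) (sym c≡c′*M₁)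
    (primitive-first-column (+ A′) (+ M₁) (+ B) x y a b d c′ u w
      (subst (λ A → A ℤ.* x ℤ.- + B ℤ.* y ≡ 1ℤ) +A≡+A′*+M₁ Ax-By≡1) uc′+wA′≡1
      (subst (λ c → a ℤ.* d ℤ.- b ℤ.* c ≡ 1ℤ) c≡c′*M₁ ad-bc≡1))

  XZ-bézout : ∃₂ λ P Q → P ℤ.* X ℤ.+ Q ℤ.* Z ≡ 1ℤ
  XZ-bézout = coprime⇒bézout X⊥Z

  P Q : ℤ
  P = proj₁ XZ-bézout
  Q = proj₁ (proj₂ XZ-bézout)
  XP+QZ≡1 : X ℤ.* P ℤ.+ Q ℤ.* Z ≡ 1ℤ
  XP+QZ≡1 = trans (cong (ℤ._+ Q ℤ.* Z) (ℤP.*-comm X P)) (proj₂ (proj₂ XZ-bézout))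

  σ : Mat2 ℤ
  σ = mat X (ℤ.- Q) Z P

  t : ℚ
  t = ℤtoℚ (ℤ.- (U ℤ.* Q ℤ.+ Y ℤ.* P)) ℚ.* fracℚ 1ℤ M₁

  σ≡W*τ*T*D : toℚ σ ≡ mulℚ (mulℚ (toℚ (mulℤ W τ)) (Tmat t)) (Dmat M₁ A)
  σ≡W*τ*T*D = trans (toℚ-factorisation X Y Z U P Q M₁ A det[W*τ]≡A XP+QZ≡1)
                    (cong (λ γ → mulℚ (mulℚ (toℚ γ) (Tmat t)) (Dmat M₁ A)) (sym W*τ≡))

  σ∈SL₂ : IsSL2ℤ σ
  σ∈SL₂ = trans (expand X P Q Z) XP+QZ≡1
    where
    expand : ∀ X P Q Z → X ℤ.* P ℤ.- ℤ.- Q ℤ.* Z ≡ X ℤ.* P ℤ.+ Q ℤ.* Z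
    expand = ℤRing.solve-∀

  C[σ]≡N/M : Cσ N σ ≡ N / M
  C[σ]≡N/M = begin
    gcd ℤ.∣ + A′ ℤ.* z ∣ N                  ≡⟨ cong₂ gcd (ℤP.abs-* (+ A′) z) N≡A′*[M₁*B] ⟩
    gcd (A′ * ℤ.∣ z ∣) (A′ * (M₁ * B))     ≡⟨ c*gcd[m,n]≡gcd[cm,cn] A′ ℤ.∣ z ∣ (M₁ * B) ⟨
    A′ * gcd ℤ.∣ z ∣ (M₁ * B)              ≡⟨ cong (A′ *_) (gcd[B*a+c,m*B]≡gcd[c,B] a b d M₁⊥B (gcd[m,n]∣m ℤ.∣ c ∣ A) ad-bc≡1) ⟩
    A′ * gB                                ≡⟨ m*n/n≡m (A′ * gB) M ⟨
    A′ * gB * M / M                        ≡⟨ cong (_/ M) N≡A′*gB*M ⟨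
    N / M                                  ∎
    where
    open ≡-Reasoning
    z : ℤ
    z = + B ℤ.* a ℤ.+ c
    M₁⊥B : Coprime M₁ B
    M₁⊥B = coprime-∣ NS⊥B M₁∣A ∣-refl
    N≡A′*[M₁*B] : N ≡ A′ * (M₁ * B)
    N≡A′*[M₁*B] = trans (sym NS*B≡N) (trans (cong (_* B) A≡A′*M₁) (*-assoc A′ M₁ B))
    N≡A′*gB*M : N ≡ A′ * gB * M
    N≡A′*gB*M = trans N≡A′*[M₁*B] (trans (cong (λ B → A′ * (M₁ * B)) B≡k*gB) (regroup A′ M₁ k gB))
      where
      regroup : ∀ A′ M₁ k gB → A′ * (M₁ * (k * gB)) ≡ A′ * gB * (M₁ * k)
      regroup = solve-∀

proposition2p2 : (N : ℕ) → N ≥ 1 → (τ : Mat2 ℤ) → IsSL2ℤ τ →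
    Σ (List ℕ) λ S → IsSubsetPN N S ×
    Σ (Mat2 ℤ) λ W → IsAtkinLehner N S W ×
    Σ ℕ λ M₁ → Σ ℕ λ M → Σ (NonZero M) λ M≠0 → 0 < M₁ × (M * M ∣ N) ×
    (M₁ ≡ gcd M (NS N S)) × (M₁ * M₁ ∣ NS N S) ×
    Σ ℚ λ t → Σ (Mat2 ℤ) λ σ →
      (toℚ σ ≡ mulℚ (mulℚ (toℚ (mulℤ W τ)) (Tmat t)) (Dmat M₁ (NS N S))) ×
      IsSL2ℤ σ × (Cσ N σ ≡ _/_ N M {{M≠0}})
proposition2p2 N N≥1 (mat a b c d) ad-bc≡1 =
  S , S⊆𝒫N , W , W∈𝒲 , M₁ , M , M≢0 , ℕ.>-nonZero⁻¹ M₁ , M²∣N , M₁≡gcd[M,A] , M₁²∣A ,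
  t , σ , σ≡W*τ*T*D , σ∈SL₂ , C[σ]≡N/M
  where open Reduction N {{ℕ.>-nonZero N≥1}} a b c d ad-bc≡1
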